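{- Let $T$ be a finite rooted ordered tree with root $r$ and let $v_1,v_2\in T\setminus\{r\}$ with $v_1\le v_2$ in depth-first traversal order of $T$. Then there is a unique node $v\in T\setminus\{r\}$ such that $v_1\in T^*[v]$ and $v_2\in T[v]$.
   Context: Depth-first traversal order $<$ on $T$ is preorder (a node precedes its descendants; children are visited left to right). $T[v]$ denotes the subtree of $T$ consisting of $v$ and all its descendants in $T$; $T^*[v]$ denotes the analogous subtree of $v$ in the dual tree $T^*$. The dual $T^*$ has the same vertex set and root $r$; with $rmc_T(u)$ the rightmost child and $ils_T(u)$ the immediate left sibling of $u$ in $T$, parents and sibling order in $T^*$ are given by: (1a) $r$ has no parent in $T^*$; (1b) if $v=rmc_T(r)$ then $v$ is the rightmost child of $r$ in $T^*$; (2) if $v=rmc_T(u)$ with $u\ne r$, then $v$ is the immediate left sibling of $u$ in $T^*$; (3) if $v=ils_T(u)$, then $v$ is the rightmost child of $u$ in $T^*$. -}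

module Defs where

open import Data.Nat using (ℕ; zero; suc; _<_)
open import Data.List using (List; []; _∷_; _++_; [_])
open import Data.Maybe using (Maybe; just; nothing)
open import Data.Product using (Σ; ∃; _×_; _,_)
open import Relation.Binary.PropositionalEquality using (_≡_; _≢_)
open import Relation.Nullary using (¬_)
open import Relation.Binary.Construct.Closure.ReflexiveTransitive using (Star)

data Tree : Set where
  node : List Tree → Tree

-- Nodes of a tree are addressed by paths from the root: lists of child indices
-- (0 = leftmost child).  The root r is the empty path [].
Path : Set
Path = List ℕ

nth : {A : Set} → List A → ℕ → Maybe A
nth []       _       = nothing
nth (x ∷ xs) zero    = just x
nth (x ∷ xs) (suc i) = nth xs i

at : Tree → Path → Maybe Tree
at t          []      = just t
at (node ts)  (i ∷ p) with nth ts i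
... | nothing = nothing
... | just t  = at t p

Node : Tree → Path → Set
Node T p = ∃ λ t → at T p ≡ just t

-- depth-first traversal (preorder) order on paths: a node precedes its
-- descendants, children visited left to right.
data _≤pre_ : Path → Path → Set where
  ≤-nil  : ∀ {q} → [] ≤pre q
  ≤-lt   : ∀ {i j p q} → i < j → (i ∷ p) ≤pre (j ∷ q)
  ≤-cons : ∀ {i p q} → p ≤pre q → (i ∷ p) ≤pre (i ∷ q)

IsRmc : Tree → Path → Path → Set
IsRmc T v u = Σ ℕ λ k → (v ≡ u ++ [ k ]) × Node T v × ¬ Node T (u ++ [ suc k ])

IsIls : Tree → Path → Path → Set
IsIls T v u = Node T u × (Σ Path λ w → Σ ℕ λ i → (u ≡ w ++ [ suc i ]) × (v ≡ w ++ [ i ]))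

-- DualParent T v p : p is the parent of v in the dual tree T*.
-- Rule (2):  if v = rmc_T(u), u ≠ r, then v is a sibling of u in T*
--            (hence has the same T*-parent as u).
-- Rule (1a): r has no parent (no constructor yields DualParent [] _).
data DualParent (T : Tree) : Path → Path → Set where
  rmc-root    : ∀ {v} → IsRmc T v [] → DualParent T v []
  rmc-nonroot : ∀ {v u p} → IsRmc T v u → u ≢ [] → DualParent T u p → DualParent T v p
  ils         : ∀ {v u} → IsIls T v u → DualParent T v u

InSubtree : Tree → Path → Path → Set
InSubtree T u v = Node T u × (Σ Path λ w → u ≡ v ++ w)

InDualSubtree : Tree → Path → Path → Set
InDualSubtree T u v = Node T u × Star (DualParent T) u v

-- The heart of the proof is a description of T*[v] for v ≠ r:
-- it consists of v and the T-subtrees of the left siblings of v (the relation ⊴ below).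
-- Every dual edge preserves this description, since an ils-edge moves one step left among
-- siblings and a rightmost child lies in the T-subtree of its parent.  Conversely, ils-edges
-- walk right along a row of siblings, and by rule (2) the rightmost child of u ≠ r shares the
-- dual parent of u, so every T-descendant of u reaches that dual parent.  Finally, v₁ ≤ v₂
-- gives v₁ ⊴ v for the ancestor v of v₂ one level below the point where v₁ and v₂ part
-- (v = v₁ if v₁ is an ancestor of v₂), and no two ancestors of v₂ both have v₁ in their region.

module Submission where

open import Defs
open import Data.List using ([])
open import Data.Product using (∃!; _×_)
open import Relation.Binary.PropositionalEquality using (_≡_; _≢_)

open import Data.Empty using (⊥-elim)
open import Data.List using (List; _∷_; _++_; [_]; length)
open import Data.List.Properties using (++-assoc; ++-identityʳ; ∷-injectiveˡ; ∷-injectiveʳ)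
open import Data.Maybe using (Maybe; just; nothing; _>>=_)
open import Data.Nat using (ℕ; zero; suc; _≤_; _<_; _≤′_; ≤′-refl; ≤′-step; z≤n; s≤s)
open import Data.Nat.Properties using (≤⇒≤′; ≤-refl; n≤1+n; n<1+n; <-irrefl; <-trans; ≤-<-trans; <⇒≤pred)
open import Data.Product using (Σ; ∃; _,_)
open import Data.Sum using (_⊎_; inj₁; inj₂)
open import Relation.Binary.Construct.Closure.ReflexiveTransitive using (Star; ε; _◅_; _◅◅_)
open import Relation.Binary.Construct.Closure.Transitive using (TransClosure; _∷_) renaming ([_] to [_]⁺)
open import Relation.Binary.PropositionalEquality using (refl; sym; trans; cong; subst)
open import Relation.Nullary using (¬_)

_⊑_ : Path → Path → Set
v ⊑ z = Σ Path λ w → z ≡ v ++ w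

snoc≢[] : ∀ (y : Path) b → y ++ [ b ] ≢ []
snoc≢[] []      b ()
snoc≢[] (_ ∷ y) b ()

nth-just⁺ : ∀ {A : Set} (xs : List A) {k} → k < length xs → ∃ λ x → nth xs k ≡ just x
nth-just⁺ (x ∷ xs) {zero}  _         = x , refl
nth-just⁺ (x ∷ xs) {suc k} (s≤s k<n) = nth-just⁺ xs k<n

nth-just⁻ : ∀ {A : Set} (xs : List A) {k x} → nth xs k ≡ just x → k < length xs
nth-just⁻ (_ ∷ xs) {zero}  _ = s≤s z≤n
nth-just⁻ (_ ∷ xs) {suc k} e = s≤s (nth-just⁻ xs e)

child : Tree → ℕ → Maybe Tree
child (node ts) k = nth ts k

at-++ : ∀ t p q → at t (p ++ q) ≡ (at t p >>= λ t′ → at t′ q)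
at-++ t         []      q = refl
at-++ (node ts) (i ∷ p) q with nth ts i
... | nothing = refl
... | just t  = at-++ t p q

at-child : ∀ t k → at t [ k ] ≡ child t k
at-child (node ts) k with nth ts k
... | nothing = refl
... | just _  = refl

Node-prefix : ∀ T p q → Node T (p ++ q) → Node T p
Node-prefix T p q (t , e) with at T p | at-++ T p q
... | just t′ | _  = t′ , refl
... | nothing | eq with trans (sym e) eq
...   | ()

⊑-Node : ∀ T {v z} → v ⊑ z → Node T z → Node T v
⊑-Node T {v} (w , refl) = Node-prefix T v w

Node-snoc⁻ : ∀ T p {k} → Node T (p ++ [ k ]) → ∃ λ ts → at T p ≡ just (node ts) × k < length ts
Node-snoc⁻ T p {k} (t , e) with at T p | at-++ T p [ k ]
... | nothing        | eq with trans (sym e) eq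
...   | ()
Node-snoc⁻ T p {k} (t , e) | just (node ts) | eq =
  ts , refl , nth-just⁻ ts (trans (sym (at-child (node ts) k)) (trans (sym eq) e))

Node-snoc⁺ : ∀ T p {ts k} → at T p ≡ just (node ts) → k < length ts → Node T (p ++ [ k ])
Node-snoc⁺ T p {ts} {k} eq k<n with nth-just⁺ ts k<n
... | t , e = t , trans (at-++ T p [ k ]) (subst (λ m → (m >>= λ t′ → at t′ [ k ]) ≡ just t) (sym eq)
                     (trans (at-child (node ts) k) e))

Node-leftSibling : ∀ T p {a c} → Node T (p ++ [ c ]) → a ≤ c → Node T (p ++ [ a ])
Node-leftSibling T p n a≤c with Node-snoc⁻ T p n
... | ts , eq , c<n = Node-snoc⁺ T p eq (≤-<-trans a≤c c<n)

rightmostSibling : ∀ T p {b} → Node T (p ++ [ b ]) → ∃ λ m → b ≤ m × IsRmc T (p ++ [ m ]) p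
rightmostSibling T p n with Node-snoc⁻ T p n
... | ts , eq , b<n with length ts in len-eq
...   | suc m = m , <⇒≤pred b<n , (m , refl , Node-snoc⁺ T p eq m<n , no-right)
  where
    m<n : m < length ts
    m<n = subst (m <_) (sym len-eq) ≤-refl
    no-right : ¬ Node T (p ++ [ suc m ])
    no-right n′ with Node-snoc⁻ T p n′
    ... | ts′ , eq′ , sm<n′ with trans (sym eq) eq′
    ...   | refl = <-irrefl (sym len-eq) sm<n′

module DualWalks (T : Tree) where

  infix 4 _↝*_ _↝⁺_

  _↝*_ : Path → Path → Set
  _↝*_ = Star (DualParent T)

  _↝⁺_ : Path → Path → Set
  _↝⁺_ = TransClosure (DualParent T)

  ⁺⇒* : ∀ {x y} → x ↝⁺ y → x ↝* y
  ⁺⇒* [ d ]⁺   = d ◅ ε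
  ⁺⇒* (d ∷ ds) = d ◅ ⁺⇒* ds

  _◅◅⁺_ : ∀ {x y z} → x ↝* y → y ↝⁺ z → x ↝⁺ z
  ε        ◅◅⁺ ds = ds
  (d ◅ ds) ◅◅⁺ es = d ∷ (ds ◅◅⁺ es)

  sameParent-↝⁺ : ∀ {x y t} → (∀ {w} → DualParent T x w → DualParent T y w) → x ↝⁺ t → y ↝⁺ t
  sameParent-↝⁺ f [ d ]⁺   = [ f d ]⁺
  sameParent-↝⁺ f (d ∷ ds) = f d ∷ ds

  rightSiblings-↝* : ∀ p {a c} → Node T (p ++ [ c ]) → a ≤′ c → (p ++ [ a ]) ↝* (p ++ [ c ])
  rightSiblings-↝* p n ≤′-refl          = ε
  rightSiblings-↝* p n (≤′-step {c} a≤c) =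
    rightSiblings-↝* p (Node-leftSibling T p n (n≤1+n c)) a≤c ◅◅ (ils (n , p , c , refl , refl) ◅ ε)

  -- Walk right to the rightmost sibling, which by rule (2) shares the dual parent of y.
  child-↝⁺ : ∀ y {b t} → y ≢ [] → Node T (y ++ [ b ]) → y ↝⁺ t → (y ++ [ b ]) ↝⁺ t
  child-↝⁺ y y≢[] n y↝⁺t with rightmostSibling T y n
  ... | m , b≤m , rmc@(_ , _ , Node-m , _) =
    rightSiblings-↝* y Node-m (≤⇒≤′ b≤m) ◅◅⁺ sameParent-↝⁺ (λ d → rmc-nonroot rmc y≢[] d) y↝⁺t

  descendant-↝⁺ : ∀ y s {t} → y ≢ [] → Node T (y ++ s) → y ↝⁺ t → (y ++ s) ↝⁺ t
  descendant-↝⁺ y []      y≢[] n y↝⁺t = subst (_↝⁺ _) (sym (++-identityʳ y)) y↝⁺t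
  descendant-↝⁺ y (b ∷ s) y≢[] n y↝⁺t =
    subst (_↝⁺ _) (++-assoc y [ b ] s)
      (descendant-↝⁺ (y ++ [ b ]) s (snoc≢[] y b) n′
        (child-↝⁺ y y≢[] (Node-prefix T (y ++ [ b ]) s n′) y↝⁺t))
    where
      n′ : Node T ((y ++ [ b ]) ++ s)
      n′ = subst (Node T) (sym (++-assoc y [ b ] s)) n

  leftSiblingSubtree-↝* : ∀ q {a c} s → Node T (q ++ a ∷ s) → Node T (q ++ [ c ]) → a < c →
                          (q ++ a ∷ s) ↝* (q ++ [ c ])
  leftSiblingSubtree-↝* q {a} s n nc a<c =
    ⁺⇒* (subst (_↝⁺ _) (++-assoc q [ a ] s) (descendant-↝⁺ (q ++ [ a ]) s (snoc≢[] q a) n′ step))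
      ◅◅ rightSiblings-↝* q nc (≤⇒≤′ a<c)
    where
      n′ : Node T ((q ++ [ a ]) ++ s)
      n′ = subst (Node T) (sym (++-assoc q [ a ] s)) n
      step : (q ++ [ a ]) ↝⁺ (q ++ [ suc a ])
      step = [ ils (Node-leftSibling T q nc a<c , q , a , refl , refl) ]⁺

-- x ◁ v : x lies in T[u] for some left sibling u of v.
infix 4 _◁_ _⊴_

data _◁_ : Path → Path → Set where
  here  : ∀ {a c s} → a < c → (a ∷ s) ◁ [ c ]
  there : ∀ {i p q} → p ◁ q → (i ∷ p) ◁ (i ∷ q)

_⊴_ : Path → Path → Set
x ⊴ v = x ≡ v ⊎ x ◁ v

◁-++ : ∀ {u v} s → u ◁ v → (u ++ s) ◁ v
◁-++ s (here a<c) = here a<c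
◁-++ s (there u◁v) = there (◁-++ s u◁v)

leftSibling-◁ : ∀ u i {v} → (u ++ [ suc i ]) ⊴ v → (u ++ [ i ]) ◁ v
leftSibling-◁ []      i (inj₁ refl)          = here ≤-refl
leftSibling-◁ []      i (inj₂ (here i+1<c))  = here (<-trans (n<1+n i) i+1<c)
leftSibling-◁ (j ∷ u) i (inj₁ refl)          = there (leftSibling-◁ u i (inj₁ refl))
leftSibling-◁ (j ∷ u) i (inj₂ (here a<c))    = here a<c
leftSibling-◁ (j ∷ u) i (inj₂ (there u◁v))   = there (leftSibling-◁ u i (inj₂ u◁v))

DualParent-◁ : ∀ {T x w v} → DualParent T x w → w ⊴ v → v ≢ [] → x ◁ v
DualParent-◁ (rmc-root _)                     (inj₁ refl) v≢[] = ⊥-elim (v≢[] refl)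
DualParent-◁ (rmc-root _)                     (inj₂ ())   v≢[]
DualParent-◁ (rmc-nonroot (k , refl , _) _ d) w⊴v         v≢[] = ◁-++ [ k ] (DualParent-◁ d w⊴v v≢[])
DualParent-◁ (ils (_ , u , i , refl , refl))  w⊴v         v≢[] = leftSibling-◁ u i w⊴v

↝*⇒⊴ : ∀ {T x v} → Star (DualParent T) x v → v ≢ [] → x ⊴ v
↝*⇒⊴ ε        v≢[] = inj₁ refl
↝*⇒⊴ (d ◅ ds) v≢[] = inj₂ (DualParent-◁ d (↝*⇒⊴ ds v≢[]) v≢[])

◁-split : ∀ {x v} → x ◁ v →
          ∃ λ q → ∃ λ a → ∃ λ c → ∃ λ s → x ≡ q ++ a ∷ s × v ≡ q ++ [ c ] × a < c
◁-split (here a<c) = [] , _ , _ , _ , refl , refl , a<c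
◁-split {i ∷ _} (there p◁q) with ◁-split p◁q
... | q , a , c , s , refl , refl , a<c = i ∷ q , a , c , s , refl , refl , a<c

⊴⇒↝* : ∀ T {x v} → x ⊴ v → Node T x → Node T v → Star (DualParent T) x v
⊴⇒↝* T (inj₁ refl) _ _ = ε
⊴⇒↝* T (inj₂ x◁v) nx nv with ◁-split x◁v
... | q , a , c , s , refl , refl , a<c = DualWalks.leftSiblingSubtree-↝* T q s nx nv a<c

≤pre⇒⊴ : ∀ {x z} → x ≢ [] → x ≤pre z → ∃ λ v → v ≢ [] × x ⊴ v × v ⊑ z
≤pre⇒⊴ {[]} x≢[] _ = ⊥-elim (x≢[] refl)
≤pre⇒⊴ {_ ∷ _} {j ∷ q} _ (≤-lt i<j) = [ j ] , (λ ()) , inj₂ (here i<j) , q , refl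
≤pre⇒⊴ {i ∷ []} {_ ∷ q} _ (≤-cons _) = [ i ] , (λ ()) , inj₁ refl , q , refl
≤pre⇒⊴ {i ∷ b ∷ p} _ (≤-cons p≤q) with ≤pre⇒⊴ (λ ()) p≤q
... | v , _ , inj₁ refl , w , refl = i ∷ v , (λ ()) , inj₁ refl , w , refl
... | v , _ , inj₂ p◁v  , w , refl = i ∷ v , (λ ()) , inj₂ (there p◁v) , w , refl

⊴-⊑-unique : ∀ {x v v′ z} → x ⊴ v → x ⊴ v′ → v ⊑ z → v′ ⊑ z → v ≡ v′
⊴-⊑-unique (inj₁ refl)         (inj₁ refl)          _         _        = refl
⊴-⊑-unique (inj₁ refl)         (inj₂ (here a<c))    (_ , refl) (_ , e) = ⊥-elim (<-irrefl (∷-injectiveˡ e) a<c)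
⊴-⊑-unique (inj₂ (here a<c))   (inj₁ refl)          (_ , e) (_ , refl) = ⊥-elim (<-irrefl (∷-injectiveˡ e) a<c)
⊴-⊑-unique (inj₁ refl)         (inj₂ (there p◁q))   (w , refl) (w′ , e) =
  cong (_ ∷_) (⊴-⊑-unique (inj₁ refl) (inj₂ p◁q) (w , refl) (w′ , ∷-injectiveʳ e))
⊴-⊑-unique (inj₂ (there p◁q))  (inj₁ refl)          (w , e) (w′ , refl) =
  cong (_ ∷_) (⊴-⊑-unique (inj₂ p◁q) (inj₁ refl) (w , ∷-injectiveʳ e) (w′ , refl))
⊴-⊑-unique (inj₂ (here _))     (inj₂ (here _))      (_ , refl) (_ , e) = cong [_] (∷-injectiveˡ e)
⊴-⊑-unique (inj₂ (here a<c))   (inj₂ (there _))     (_ , refl) (_ , e) = ⊥-elim (<-irrefl (sym (∷-injectiveˡ e)) a<c)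
⊴-⊑-unique (inj₂ (there _))    (inj₂ (here a<c))    (_ , e) (_ , refl) = ⊥-elim (<-irrefl (sym (∷-injectiveˡ e)) a<c)
⊴-⊑-unique (inj₂ (there p◁q))  (inj₂ (there p◁q′)) (w , refl) (w′ , e) =
  cong (_ ∷_) (⊴-⊑-unique (inj₂ p◁q) (inj₂ p◁q′) (w , refl) (w′ , ∷-injectiveʳ e))

theorem5 : (T : Tree) (v₁ v₂ : Path) → Node T v₁ → Node T v₂ → v₁ ≢ [] → v₂ ≢ [] → v₁ ≤pre v₂
    → ∃! _≡_ (λ v → Node T v × v ≢ [] × InDualSubtree T v₁ v × InSubtree T v₂ v)
theorem5 T v₁ v₂ n₁ n₂ v₁≢[] _ v₁≤v₂ with ≤pre⇒⊴ v₁≢[] v₁≤v₂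
... | v , v≢[] , v₁⊴v , v⊑v₂ =
  v , (nv , v≢[] , (n₁ , ⊴⇒↝* T v₁⊴v n₁ nv) , (n₂ , v⊑v₂)) , unique
  where
    nv : Node T v
    nv = ⊑-Node T v⊑v₂ n₂
    unique : ∀ {y} → Node T y × y ≢ [] × InDualSubtree T v₁ y × InSubtree T v₂ y → v ≡ y
    unique (_ , y≢[] , (_ , v₁↝*y) , (_ , y⊑v₂)) = ⊴-⊑-unique v₁⊴v (↝*⇒⊴ v₁↝*y y≢[]) v⊑v₂ y⊑v₂
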